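{- Let $G$ be a connected graph on vertex set $V=\{1,\dots,n\}$ with $n$ divisible by $4$ and Laplacian matrix $L$. Let $\bar y$ be a minimizer of $$\min\{y^TLy:\ y^T\mathbf 1=0,\ \|y\|=1,\ y_i\in\{1/\sqrt n,-1/\sqrt n\}\ \forall i\},$$ and let $\bar x$ be a minimizer of $$\min\{x^TLx:\ x^T\mathbf 1=0,\ \|x\|=1,\ \bar y^Tx=0,\ x_i\in\{1/\sqrt n,-1/\sqrt n\}\ \forall i\}.$$ Let $A=\{i:\bar y_i=1/\sqrt n\}$, $B=\{i:\bar y_i=-1/\sqrt n\}$, $A_1=\{i\in A:\bar x_i=1/\sqrt n\}$, $A_2=\{i\in A:\bar x_i=-1/\sqrt n\}$, $B_1=\{i\in B:\bar x_i=1/\sqrt n\}$, $B_2=\{i\in B:\bar x_i=-1/\sqrt n\}$. Then $\{A,B\}$ is a minimum cut of $G$ and $\{A_1,A_2,B_1,B_2\}$ is an organized partition of $\{A,B\}$.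
   Context: $\mathbf 1$ is the all-ones vector and $L$ is the Laplacian (degree matrix minus adjacency matrix). For $X,Y\subseteq V$, $E(X,Y)$ is the number of edges with one endpoint in $X$ and the other in $Y$. A bisection (cut) is a partition $\{A,B\}$ of $V$ with $|A|=|B|$; a minimum cut is a bisection minimizing $E(A,B)$. For a bisection $\{A,B\}$, an organized partition is a decomposition $A=A_1\cup A_2$, $B=B_1\cup B_2$ into disjoint sets with $|A_1|=|A_2|$, $|B_1|=|B_2|$ minimizing $E(A_1,A_2)+E(B_1,B_2)-E(A_1,B_1)-E(A_2,B_2)$ among all such decompositions. -}

module Defs where

open import Data.Nat using (ℕ; zero; suc)
open import Data.Fin using (Fin; zero; suc; _≟_)
open import Data.Bool using (Bool; true; false; _∧_; _∨_; not; if_then_else_)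
open import Data.Integer using (ℤ; +_; -_; _+_; _*_; _-_; _≤_)
open import Data.Product using (_×_)
open import Relation.Nullary using (does)
open import Relation.Binary.PropositionalEquality using (_≡_)

sumℤ : ∀ {n} → (Fin n → ℤ) → ℤ
sumℤ {zero}  f = + 0
sumℤ {suc n} f = f zero + sumℤ (λ i → f (suc i))

sumℕ : ∀ {n} → (Fin n → ℕ) → ℕ
sumℕ {zero}  f = 0
sumℕ {suc n} f = f zero Data.Nat.+ sumℕ (λ i → f (suc i))

count : ∀ {n} → (Fin n → Bool) → ℕ
count {zero}  P = 0
count {suc n} P = (if P zero then 1 else 0) Data.Nat.+ count (λ i → P (suc i))

record Graph (n : ℕ) : Set where
  field
    adj    : Fin n → Fin n → Bool
    sym    : ∀ i j → adj i j ≡ adj j i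
    irrefl : ∀ i → adj i i ≡ false
open Graph public

data Reach {n} (G : Graph n) (u : Fin n) : Fin n → Set where
  here : Reach G u u
  step : ∀ {v w} → Reach G u v → adj G v w ≡ true → Reach G u w

Connected : ∀ {n} → Graph n → Set
Connected G = ∀ u v → Reach G u v

degree : ∀ {n} → Graph n → Fin n → ℕ
degree G i = count (adj G i)

Laplacian : ∀ {n} → Graph n → Fin n → Fin n → ℤ
Laplacian G i j =
  if does (i ≟ j) then + degree G i
  else (if adj G i j then - (+ 1) else + 0)

quad : ∀ {n} → (Fin n → Fin n → ℤ) → (Fin n → ℤ) → ℤ
quad M v = sumℤ (λ i → sumℤ (λ j → v i * M i j * v j))

dot : ∀ {n} → (Fin n → ℤ) → (Fin n → ℤ) → ℤ
dot u v = sumℤ (λ i → u i * v i)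

ones : ∀ {n} → Fin n → ℤ
ones _ = + 1

-- ±1/√n vectors, represented (scaled by √n) as sign vectors.
-- s : Fin n → Bool encodes y with y_i = 1/√n if s i = true, -1/√n otherwise;
-- vec s = √n · y ∈ {±1}^n.

sign : Bool → ℤ
sign true  = + 1
sign false = - (+ 1)

vec : ∀ {n} → (Fin n → Bool) → Fin n → ℤ
vec s i = sign (s i)

-- feasible set of the first problem: y^T 1 = 0 (‖y‖ = 1 holds automatically)
Feasible₁ : ∀ {n} → (Fin n → Bool) → Set
Feasible₁ s = dot (vec s) ones ≡ + 0

Minimizer₁ : ∀ {n} → Graph n → (Fin n → Bool) → Set
Minimizer₁ G s =
  Feasible₁ s × (∀ s' → Feasible₁ s' →
    quad (Laplacian G) (vec s) ≤ quad (Laplacian G) (vec s'))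

Feasible₂ : ∀ {n} → (Fin n → Bool) → (Fin n → Bool) → Set
Feasible₂ ybar s = Feasible₁ s × dot (vec ybar) (vec s) ≡ + 0

Minimizer₂ : ∀ {n} → Graph n → (Fin n → Bool) → (Fin n → Bool) → Set
Minimizer₂ G ybar s =
  Feasible₂ ybar s × (∀ s' → Feasible₂ ybar s' →
    quad (Laplacian G) (vec s) ≤ quad (Laplacian G) (vec s'))

-- E(X,Y): number of (ordered) pairs (i,j), i ∈ X, j ∈ Y, with ij an edge;
-- for disjoint X, Y this is the number of edges between X and Y.
E : ∀ {n} → Graph n → (Fin n → Bool) → (Fin n → Bool) → ℕ
E G X Y = sumℕ (λ i → count (λ j → X i ∧ Y j ∧ adj G i j))

Bisection : ∀ {n} → (Fin n → Bool) → (Fin n → Bool) → Set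
Bisection A B = (∀ i → B i ≡ not (A i)) × count A ≡ count B

MinimumCut : ∀ {n} → Graph n → (Fin n → Bool) → (Fin n → Bool) → Set
MinimumCut G A B =
  Bisection A B × (∀ A' B' → Bisection A' B' → E G A B Data.Nat.≤ E G A' B')

Decomposition : ∀ {n} → (A B A₁ A₂ B₁ B₂ : Fin n → Bool) → Set
Decomposition A B A₁ A₂ B₁ B₂ =
  (∀ i → A i ≡ (A₁ i ∨ A₂ i)) × (∀ i → (A₁ i ∧ A₂ i) ≡ false) ×
  (∀ i → B i ≡ (B₁ i ∨ B₂ i)) × (∀ i → (B₁ i ∧ B₂ i) ≡ false) ×
  count A₁ ≡ count A₂ × count B₁ ≡ count B₂

organizedObjective : ∀ {n} → Graph n → (A₁ A₂ B₁ B₂ : Fin n → Bool) → ℤ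
organizedObjective G A₁ A₂ B₁ B₂ =
  + E G A₁ A₂ + + E G B₁ B₂ - + E G A₁ B₁ - + E G A₂ B₂

OrganizedPartition : ∀ {n} → Graph n → (A B A₁ A₂ B₁ B₂ : Fin n → Bool) → Set
OrganizedPartition G A B A₁ A₂ B₁ B₂ =
  Decomposition A B A₁ A₂ B₁ B₂ ×
  (∀ A₁' A₂' B₁' B₂' → Decomposition A B A₁' A₂' B₁' B₂' →
     organizedObjective G A₁ A₂ B₁ B₂ ≤ organizedObjective G A₁' A₂' B₁' B₂')

module Submission where

-- For a sign vector s the Laplacian form is four times the cut,
-- vec(s)ᵀ L vec(s) = 4·E(s, ¬s), because each edge between the two sides
-- contributes (1 - (-1))² = 4.  The constraint 1ᵀs = 0 says that s and ¬s
-- have equal size, so the first problem minimises the cut over bisections.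
-- Two sign vectors y, x cut the vertex set into the four cells
-- A₁ = y∧x, A₂ = y∧¬x, B₁ = ¬y∧x, B₂ = ¬y∧¬x; the constraints of the second
-- problem say exactly |A₁| = |A₂| and |B₁| = |B₂|, and additivity of E over
-- disjoint unions gives  objective(A₁,A₂,B₁,B₂) = E(x,¬x) - E(y,¬y).
-- Conversely every decomposition of {y, ¬y} is the cell decomposition of
-- x = A₁ ∪ B₁.  So minimising xᵀLx over the second feasible set minimises the
-- organized objective.

open import Defs hiding (sym)
open import Data.Nat as ℕ using (ℕ; zero; suc; ⌊_/2⌋)
import Data.Nat.Properties as ℕP
open import Data.Nat.Divisibility using (_∣_)
open import Data.Integer as ℤ using (ℤ; +_; -_; _+_; _*_; _-_)
import Data.Integer.Properties as ℤP
open import Data.Integer.Solver using (module +-*-Solver)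
open import Data.Fin using (Fin; zero; suc; _≟_)
open import Data.Bool using (Bool; true; false; _∧_; _∨_; not; _xor_; if_then_else_)
import Data.Bool.Properties as BoolP
open import Data.Product using (_×_; _,_; proj₁; proj₂)
open import Data.Product.Function.NonDependent.Propositional using (_×-⇔_)
open import Function using (_∘_; id)
open import Function.Bundles using (_⇔_; mk⇔; Equivalence)
open import Function.Construct.Composition using (_⇔-∘_)
open import Relation.Nullary using (does; yes; no)
open import Relation.Binary.PropositionalEquality
import Algebra.Properties.Semiring.Sum as SemiringSum
import Algebra.Properties.CommutativeSemigroup as CommutativeSemigroupProperties
import Algebra.Properties.Group as GroupProperties
open import Algebra.Bundles using (CommutativeMonoid; AbelianGroup)

module ℕΣ = SemiringSum ℕP.+-*-semiring
module ℤΣ = SemiringSum ℤP.+-*-semiring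
open CommutativeSemigroupProperties ℕP.+-commutativeSemigroup using (interchange)
open CommutativeSemigroupProperties
  (CommutativeMonoid.commutativeSemigroup BoolP.∧-commutativeMonoid)
  using () renaming (x∙yz≈y∙xz to ∧-swapˡ)
open GroupProperties (AbelianGroup.group ℤP.+-0-abelianGroup) using (∙-cancelʳ)

sumℕ≡∑ : ∀ {n} (f : Fin n → ℕ) → sumℕ f ≡ ℕΣ.sum f
sumℕ≡∑ {zero}  f = refl
sumℕ≡∑ {suc n} f = cong (f zero ℕ.+_) (sumℕ≡∑ (f ∘ suc))

sumℤ≡∑ : ∀ {n} (f : Fin n → ℤ) → sumℤ f ≡ ℤΣ.sum f
sumℤ≡∑ {zero}  f = refl
sumℤ≡∑ {suc n} f = cong (λ t → f zero + t) (sumℤ≡∑ (f ∘ suc))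

sumℕ-cong : ∀ {n} {f g : Fin n → ℕ} → f ≗ g → sumℕ f ≡ sumℕ g
sumℕ-cong {f = f} {g} f≗g rewrite sumℕ≡∑ f | sumℕ≡∑ g = ℕΣ.sum-cong-≗ f≗g

sumℤ-cong : ∀ {n} {f g : Fin n → ℤ} → f ≗ g → sumℤ f ≡ sumℤ g
sumℤ-cong {f = f} {g} f≗g rewrite sumℤ≡∑ f | sumℤ≡∑ g = ℤΣ.sum-cong-≗ f≗g

sumℕ-+ : ∀ {n} (f g : Fin n → ℕ) →
  sumℕ (λ i → f i ℕ.+ g i) ≡ sumℕ f ℕ.+ sumℕ g
sumℕ-+ f g rewrite sumℕ≡∑ (λ i → f i ℕ.+ g i) | sumℕ≡∑ f | sumℕ≡∑ g =
  ℕΣ.∑-distrib-+ f g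

sumℤ-+ : ∀ {n} (f g : Fin n → ℤ) → sumℤ (λ i → f i + g i) ≡ sumℤ f + sumℤ g
sumℤ-+ f g rewrite sumℤ≡∑ (λ i → f i + g i) | sumℤ≡∑ f | sumℤ≡∑ g =
  ℤΣ.∑-distrib-+ f g

sumℕ-*ˡ : ∀ {n} c (f : Fin n → ℕ) → sumℕ (λ i → c ℕ.* f i) ≡ c ℕ.* sumℕ f
sumℕ-*ˡ c f rewrite sumℕ≡∑ (λ i → c ℕ.* f i) | sumℕ≡∑ f =
  sym (ℕΣ.*-distribˡ-sum c f)

sumℕ-comm : ∀ {m n} (f : Fin m → Fin n → ℕ) →
  sumℕ (λ i → sumℕ (f i)) ≡ sumℕ (λ j → sumℕ (λ i → f i j))
sumℕ-comm f = begin
  sumℕ (λ i → sumℕ (f i))                ≡⟨ sumℕ≡∑ (λ i → sumℕ (f i)) ⟩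
  ℕΣ.sum (λ i → sumℕ (f i))              ≡⟨ ℕΣ.sum-cong-≗ (λ i → sumℕ≡∑ (f i)) ⟩
  ℕΣ.sum (λ i → ℕΣ.sum (f i))            ≡⟨ ℕΣ.∑-comm f ⟩
  ℕΣ.sum (λ j → ℕΣ.sum (λ i → f i j))    ≡⟨ ℕΣ.sum-cong-≗ (λ j → sumℕ≡∑ (λ i → f i j)) ⟨
  ℕΣ.sum (λ j → sumℕ (λ i → f i j))      ≡⟨ sumℕ≡∑ (λ j → sumℕ (λ i → f i j)) ⟨
  sumℕ (λ j → sumℕ (λ i → f i j))        ∎
  where open ≡-Reasoning

sumℤ-embed : ∀ {n} (f : Fin n → ℕ) → sumℤ (λ i → + f i) ≡ + sumℕ f
sumℤ-embed {zero}  f = refl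
sumℤ-embed {suc n} f = cong (λ t → + f zero + t) (sumℤ-embed (f ∘ suc))

sumℤ-scaled-embed : ∀ {n} c (f : Fin n → ℕ) → sumℤ (λ i → + (c ℕ.* f i)) ≡ + (c ℕ.* sumℕ f)
sumℤ-scaled-embed c f = trans (sumℤ-embed (λ i → c ℕ.* f i)) (cong +_ (sumℕ-*ˡ c f))

δ : ∀ {n} → Fin n → Fin n → ℤ → ℤ
δ i j c = if does (i ≟ j) then c else + 0

δ-sum : ∀ {n} (i : Fin n) (c : ℤ) → sumℤ (λ j → δ i j c) ≡ c
δ-sum {suc n} zero    c = trans (cong (λ t → c + t) zero-sum) (ℤP.+-identityʳ c)
  where
  zero-sum : sumℤ {n} (λ _ → + 0) ≡ + 0
  zero-sum = trans (sumℤ≡∑ {n} (λ _ → + 0)) (ℤΣ.sum-replicate-zero n)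
δ-sum {suc n} (suc i) c = trans (ℤP.+-identityˡ _) (δ-sum i c)

ind : Bool → ℕ
ind b = if b then 1 else 0

ind-∧ : ∀ a b → ind (a ∧ b) ≡ ind a ℕ.* ind b
ind-∧ true  true  = refl
ind-∧ true  false = refl
ind-∧ false _     = refl

count≡sumℕ : ∀ {n} (P : Fin n → Bool) → count P ≡ sumℕ (λ i → ind (P i))
count≡sumℕ {zero}  P = refl
count≡sumℕ {suc n} P = cong (ind (P zero) ℕ.+_) (count≡sumℕ (P ∘ suc))

count-cong : ∀ {n} {P Q : Fin n → Bool} → P ≗ Q → count P ≡ count Q
count-cong {P = P} {Q} P≗Q = begin
  count P                    ≡⟨ count≡sumℕ P ⟩
  sumℕ (λ i → ind (P i))     ≡⟨ sumℕ-cong (cong ind ∘ P≗Q) ⟩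
  sumℕ (λ i → ind (Q i))     ≡⟨ count≡sumℕ Q ⟨
  count Q                    ∎
  where open ≡-Reasoning

record DisjointUnion {n} (P Q R : Fin n → Bool) : Set where
  constructor disjoint-union
  field ind-+ : ∀ i → ind (P i) ≡ ind (Q i) ℕ.+ ind (R i)
open DisjointUnion

count-⊎ : ∀ {n} {P Q R : Fin n → Bool} →
  DisjointUnion P Q R → count P ≡ count Q ℕ.+ count R
count-⊎ {P = P} {Q} {R} P=Q⊎R = begin
  count P                                  ≡⟨ count≡sumℕ P ⟩
  sumℕ (λ i → ind (P i))                   ≡⟨ sumℕ-cong (ind-+ P=Q⊎R) ⟩
  sumℕ (λ i → ind (Q i) ℕ.+ ind (R i))     ≡⟨ sumℕ-+ (λ i → ind (Q i)) (λ i → ind (R i)) ⟩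
  sumℕ (λ i → ind (Q i)) ℕ.+ sumℕ (λ i → ind (R i))
                                           ≡⟨ cong₂ ℕ._+_ (count≡sumℕ Q) (count≡sumℕ R) ⟨
  count Q ℕ.+ count R                      ∎
  where open ≡-Reasoning

∧-⊎ : ∀ {a a₁ a₂} b → ind a ≡ ind a₁ ℕ.+ ind a₂ →
  ind (a ∧ b) ≡ ind (a₁ ∧ b) ℕ.+ ind (a₂ ∧ b)
∧-⊎ {a} {a₁} {a₂} b a=a₁⊎a₂ = begin
  ind (a ∧ b)                               ≡⟨ ind-∧ a b ⟩
  ind a ℕ.* ind b                           ≡⟨ cong (ℕ._* ind b) a=a₁⊎a₂ ⟩
  (ind a₁ ℕ.+ ind a₂) ℕ.* ind b             ≡⟨ ℕP.*-distribʳ-+ (ind b) (ind a₁) (ind a₂) ⟩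
  ind a₁ ℕ.* ind b ℕ.+ ind a₂ ℕ.* ind b     ≡⟨ cong₂ ℕ._+_ (ind-∧ a₁ b) (ind-∧ a₂ b) ⟨
  ind (a₁ ∧ b) ℕ.+ ind (a₂ ∧ b)             ∎
  where open ≡-Reasoning

E-cong : ∀ {n} (G : Graph n) {X X' Y Y' : Fin n → Bool} →
  X ≗ X' → Y ≗ Y' → E G X Y ≡ E G X' Y'
E-cong G X≗X' Y≗Y' = sumℕ-cong λ i → count-cong λ j →
  cong₂ (λ u v → u ∧ v ∧ adj G i j) (X≗X' i) (Y≗Y' j)

E≡double-sum : ∀ {n} (G : Graph n) (X Y : Fin n → Bool) →
  E G X Y ≡ sumℕ (λ i → sumℕ (λ j → ind (X i ∧ Y j ∧ adj G i j)))
E≡double-sum G X Y = sumℕ-cong (λ i → count≡sumℕ (λ j → X i ∧ Y j ∧ adj G i j))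

E-sym : ∀ {n} (G : Graph n) (X Y : Fin n → Bool) → E G X Y ≡ E G Y X
E-sym G X Y = begin
  E G X Y                                                  ≡⟨ E≡double-sum G X Y ⟩
  sumℕ (λ i → sumℕ (λ j → ind (X i ∧ Y j ∧ adj G i j)))    ≡⟨ sumℕ-comm (λ i j → ind (X i ∧ Y j ∧ adj G i j)) ⟩
  sumℕ (λ j → sumℕ (λ i → ind (X i ∧ Y j ∧ adj G i j)))    ≡⟨ sumℕ-cong (λ j → sumℕ-cong λ i →
                                                                cong ind (flip-edge i j)) ⟩
  sumℕ (λ j → sumℕ (λ i → ind (Y j ∧ X i ∧ adj G j i)))    ≡⟨ E≡double-sum G Y X ⟨
  E G Y X                                                  ∎
  where
  open ≡-Reasoning
  flip-edge : ∀ i j → (X i ∧ Y j ∧ adj G i j) ≡ (Y j ∧ X i ∧ adj G j i)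
  flip-edge i j = trans (∧-swapˡ (X i) (Y j) _) (cong (λ e → Y j ∧ X i ∧ e) (Graph.sym G i j))

E-⊎ˡ : ∀ {n} (G : Graph n) {X X₁ X₂ : Fin n → Bool} (Y : Fin n → Bool) →
  DisjointUnion X X₁ X₂ → E G X Y ≡ E G X₁ Y ℕ.+ E G X₂ Y
E-⊎ˡ G {X₁ = X₁} {X₂} Y X=X₁⊎X₂ =
  trans (sumℕ-cong λ i → count-⊎ (disjoint-union λ j →
           ∧-⊎ {a₁ = X₁ i} {X₂ i} (Y j ∧ adj G i j) (ind-+ X=X₁⊎X₂ i)))
        (sumℕ-+ (λ i → count (λ j → X₁ i ∧ Y j ∧ adj G i j))
                (λ i → count (λ j → X₂ i ∧ Y j ∧ adj G i j)))

E-⊎ʳ : ∀ {n} (G : Graph n) (X : Fin n → Bool) {Y Y₁ Y₂ : Fin n → Bool} →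
  DisjointUnion Y Y₁ Y₂ → E G X Y ≡ E G X Y₁ ℕ.+ E G X Y₂
E-⊎ʳ G X {Y} {Y₁} {Y₂} Y=Y₁⊎Y₂ = begin
  E G X Y                  ≡⟨ E-sym G X Y ⟩
  E G Y X                  ≡⟨ E-⊎ˡ G X Y=Y₁⊎Y₂ ⟩
  E G Y₁ X ℕ.+ E G Y₂ X    ≡⟨ cong₂ ℕ._+_ (E-sym G Y₁ X) (E-sym G Y₂ X) ⟩
  E G X Y₁ ℕ.+ E G X Y₂    ∎
  where open ≡-Reasoning

E-⊎ : ∀ {n} (G : Graph n) {X X₁ X₂ Y Y₁ Y₂ : Fin n → Bool} →
  DisjointUnion X X₁ X₂ → DisjointUnion Y Y₁ Y₂ →
  E G X Y ≡ (E G X₁ Y₁ ℕ.+ E G X₁ Y₂) ℕ.+ (E G X₂ Y₁ ℕ.+ E G X₂ Y₂)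
E-⊎ G {X₁ = X₁} {X₂} {Y} X=X₁⊎X₂ Y=Y₁⊎Y₂ =
  trans (E-⊎ˡ G Y X=X₁⊎X₂) (cong₂ ℕ._+_ (E-⊎ʳ G X₁ Y=Y₁⊎Y₂) (E-⊎ʳ G X₂ Y=Y₁⊎Y₂))

cut : ∀ {n} → Graph n → (Fin n → Bool) → ℕ
cut G s = E G s (λ i → not (s i))

-- One entry of vᵀLv for v = vec s, corrected by the adjacency indicator:
-- off the diagonal an edge contributes -sᵢsⱼ, i.e. 1 - 2·[sᵢ ≠ sⱼ].
laplacian-entry : ∀ {n} (G : Graph n) (s : Fin n → Bool) (i j : Fin n) →
  vec s i * Laplacian G i j * vec s j + + ind (adj G i j)
    ≡ δ i j (+ degree G i) + + (2 ℕ.* ind ((s i xor s j) ∧ adj G i j))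
laplacian-entry G s i j with i ≟ j
... | yes refl rewrite Graph.irrefl G i | BoolP.xor-same (s i) =
  cong (_+ + 0) (sign-square (s i) (+ degree G i))
  where
  sign-square : ∀ b d → sign b * d * sign b ≡ d
  sign-square true  d = trans (ℤP.*-identityʳ (+ 1 * d)) (ℤP.*-identityˡ d)
  sign-square false d = trans (ℤP.*-comm (- + 1 * d) (- + 1))
                              (trans (sym (ℤP.*-assoc (- + 1) (- + 1) d)) (ℤP.*-identityˡ d))
... | no _ = off-diagonal (s i) (s j) (adj G i j)
  where
  off-diagonal : ∀ a b e → sign a * (if e then - + 1 else + 0) * sign b + + ind e
                             ≡ + (2 ℕ.* ind ((a xor b) ∧ e))
  off-diagonal true  true  true  = refl
  off-diagonal true  true  false = refl
  off-diagonal true  false true  = refl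
  off-diagonal true  false false = refl
  off-diagonal false true  true  = refl
  off-diagonal false true  false = refl
  off-diagonal false false true  = refl
  off-diagonal false false false = refl

-- Row i of vᵀLv counts, twice, the edges at i that cross the cut; the degree
-- of i, added on both sides, cancels against the diagonal entry.
laplacian-row : ∀ {n} (G : Graph n) (s : Fin n → Bool) (i : Fin n) →
  sumℤ (λ j → vec s i * Laplacian G i j * vec s j)
    ≡ + (2 ℕ.* count (λ j → (s i xor s j) ∧ adj G i j))
laplacian-row G s i = ∙-cancelʳ (+ d) _ _ (begin
  sumℤ v + + d                                       ≡⟨ cong (λ t → sumℤ v + t) degree-as-sum ⟩
  sumℤ v + sumℤ (λ j → + ind (adj G i j))            ≡⟨ sumℤ-+ v (λ j → + ind (adj G i j)) ⟨
  sumℤ (λ j → v j + + ind (adj G i j))               ≡⟨ sumℤ-cong (laplacian-entry G s i) ⟩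
  sumℤ (λ j → δ i j (+ d) + + (2 ℕ.* crossing j))   ≡⟨ sumℤ-+ (λ j → δ i j (+ d)) _ ⟩
  sumℤ (λ j → δ i j (+ d)) + sumℤ (λ j → + (2 ℕ.* crossing j))
                                                     ≡⟨ cong₂ _+_ (δ-sum i (+ d)) crossings-as-sum ⟩
  + d + + (2 ℕ.* c)                                  ≡⟨ ℤP.+-comm (+ d) (+ (2 ℕ.* c)) ⟩
  + (2 ℕ.* c) + + d                                  ∎)
  where
  open ≡-Reasoning
  d = degree G i
  c = count (λ j → (s i xor s j) ∧ adj G i j)
  v = λ j → vec s i * Laplacian G i j * vec s j
  crossing = λ j → ind ((s i xor s j) ∧ adj G i j)
  degree-as-sum : + d ≡ sumℤ (λ j → + ind (adj G i j))
  degree-as-sum = trans (cong +_ (count≡sumℕ (adj G i))) (sym (sumℤ-embed (ind ∘ adj G i)))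
  crossings-as-sum : sumℤ (λ j → + (2 ℕ.* crossing j)) ≡ + (2 ℕ.* c)
  crossings-as-sum = trans (sumℤ-scaled-embed 2 crossing)
                           (cong (λ m → + (2 ℕ.* m)) (sym (count≡sumℕ (λ j → (s i xor s j) ∧ adj G i j))))

-- Summed over all rows, the crossing edges are counted once from each side.
crossings-cut : ∀ {n} (G : Graph n) (s : Fin n → Bool) →
  sumℕ (λ i → count (λ j → (s i xor s j) ∧ adj G i j)) ≡ 2 ℕ.* cut G s
crossings-cut G s = begin
  sumℕ (λ i → count (λ j → (s i xor s j) ∧ adj G i j))
      ≡⟨ sumℕ-cong (λ i → count-⊎ (disjoint-union λ j → xor-split (s i) (s j) (adj G i j))) ⟩
  sumℕ (λ i → E-row s ¬s i ℕ.+ E-row ¬s s i)  ≡⟨ sumℕ-+ (E-row s ¬s) (E-row ¬s s) ⟩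
  E G s ¬s ℕ.+ E G ¬s s                       ≡⟨ cong (cut G s ℕ.+_) (E-sym G ¬s s) ⟩
  cut G s ℕ.+ cut G s                         ≡⟨ cong (cut G s ℕ.+_) (ℕP.*-identityˡ (cut G s)) ⟨
  2 ℕ.* cut G s                               ∎
  where
  open ≡-Reasoning
  ¬s = λ i → not (s i)
  E-row : (Fin _ → Bool) → (Fin _ → Bool) → Fin _ → ℕ
  E-row X Y i = count (λ j → X i ∧ Y j ∧ adj G i j)
  xor-split : ∀ a b e → ind ((a xor b) ∧ e) ≡ ind (a ∧ not b ∧ e) ℕ.+ ind (not a ∧ b ∧ e)
  xor-split true  true  e = refl
  xor-split true  false e = sym (ℕP.+-identityʳ (ind e))
  xor-split false true  e = refl
  xor-split false false e = refl

laplacian-cut : ∀ {n} (G : Graph n) (s : Fin n → Bool) →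
  quad (Laplacian G) (vec s) ≡ + (4 ℕ.* cut G s)
laplacian-cut G s = begin
  quad (Laplacian G) (vec s)                 ≡⟨ sumℤ-cong (laplacian-row G s) ⟩
  sumℤ (λ i → + (2 ℕ.* crossings i))         ≡⟨ sumℤ-scaled-embed 2 crossings ⟩
  + (2 ℕ.* sumℕ crossings)                   ≡⟨ cong (λ m → + (2 ℕ.* m)) (crossings-cut G s) ⟩
  + (2 ℕ.* (2 ℕ.* cut G s))                  ≡⟨ cong +_ (ℕP.*-assoc 2 2 (cut G s)) ⟨
  + (4 ℕ.* cut G s)                          ∎
  where
  open ≡-Reasoning
  crossings = λ i → count (λ j → (s i xor s j) ∧ adj G i j)

cut-mono : ∀ {n} (G : Graph n) (s t : Fin n → Bool) →
  quad (Laplacian G) (vec s) ℤ.≤ quad (Laplacian G) (vec t) → cut G s ℕ.≤ cut G t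
cut-mono G s t s≤t rewrite laplacian-cut G s | laplacian-cut G t =
  ℕP.*-cancelˡ-≤ 4 (ℤP.drop‿+≤+ s≤t)

Balanced : ∀ {n} → (Fin n → Bool) → Set
Balanced P = count P ≡ count (λ i → not (P i))

≡-⇔ : ∀ {A : Set} {a a' b b' : A} → a ≡ a' → b ≡ b' → (a ≡ b) ⇔ (a' ≡ b')
≡-⇔ refl refl = mk⇔ id id

sign-sum : ∀ {n} (P : Fin n → Bool) →
  sumℤ (λ i → sign (P i)) + + count (λ i → not (P i)) ≡ + count P
sign-sum P = begin
  sumℤ signs + + count ¬P                          ≡⟨ cong (λ t → sumℤ signs + t) count¬P-as-sum ⟩
  sumℤ signs + sumℤ (λ i → + ind (not (P i)))      ≡⟨ sumℤ-+ signs (λ i → + ind (not (P i))) ⟨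
  sumℤ (λ i → sign (P i) + + ind (not (P i)))      ≡⟨ sumℤ-cong (sign-plus-complement ∘ P) ⟩
  sumℤ (λ i → + ind (P i))                         ≡⟨ sumℤ-embed (ind ∘ P) ⟩
  + sumℕ (ind ∘ P)                                 ≡⟨ cong +_ (count≡sumℕ P) ⟨
  + count P                                        ∎
  where
  open ≡-Reasoning
  signs = λ i → sign (P i)
  ¬P = λ i → not (P i)
  count¬P-as-sum : + count ¬P ≡ sumℤ (λ i → + ind (not (P i)))
  count¬P-as-sum = trans (cong +_ (count≡sumℕ ¬P)) (sym (sumℤ-embed (ind ∘ ¬P)))
  sign-plus-complement : ∀ b → sign b + + ind (not b) ≡ + ind b
  sign-plus-complement true  = refl
  sign-plus-complement false = refl

sign-sum-zero⇔balanced : ∀ {n} (P : Fin n → Bool) →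
  (sumℤ (λ i → sign (P i)) ≡ + 0) ⇔ Balanced P
sign-sum-zero⇔balanced P = mk⇔ to from
  where
  ¬P = λ i → not (P i)
  to : sumℤ (λ i → sign (P i)) ≡ + 0 → Balanced P
  to sum≡0 = ℤP.+-injective (trans (sym (sign-sum P)) (cong (_+ + count ¬P) sum≡0))
  from : Balanced P → sumℤ (λ i → sign (P i)) ≡ + 0
  from balanced = ∙-cancelʳ (+ count ¬P) _ (+ 0) (trans (sign-sum P) (cong +_ balanced))

feasible₁⇔balanced : ∀ {n} (s : Fin n → Bool) → Feasible₁ s ⇔ Balanced s
feasible₁⇔balanced s =
  sign-sum-zero⇔balanced s ⇔-∘ ≡-⇔ (sumℤ-cong (λ i → ℤP.*-identityʳ (sign (s i)))) refl

-- The set where x agrees with y; the sign of y·x is the sign of agreement.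
agreement : ∀ {n} → (Fin n → Bool) → (Fin n → Bool) → Fin n → Bool
agreement y x i = if y i then x i else not (x i)

orthogonal⇔agreement-balanced : ∀ {n} (y x : Fin n → Bool) →
  (dot (vec y) (vec x) ≡ + 0) ⇔ Balanced (agreement y x)
orthogonal⇔agreement-balanced y x =
  sign-sum-zero⇔balanced (agreement y x) ⇔-∘
    ≡-⇔ (sumℤ-cong (λ i → sign-product (y i) (x i))) refl
  where
  sign-product : ∀ a b → sign a * sign b ≡ sign (if a then b else not b)
  sign-product true  true  = refl
  sign-product true  false = refl
  sign-product false true  = refl
  sign-product false false = refl

cellA₁ cellA₂ cellB₁ cellB₂ : ∀ {n} → (Fin n → Bool) → (Fin n → Bool) → Fin n → Bool
cellA₁ y x i = y i ∧ x i
cellA₂ y x i = y i ∧ not (x i)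
cellB₁ y x i = not (y i) ∧ x i
cellB₂ y x i = not (y i) ∧ not (x i)

record CellIndicators (a b : Bool) : Set where
  constructor cell-indicators
  field
    on-x         : ind b ≡ ind (a ∧ b) ℕ.+ ind (not a ∧ b)
    on-¬x        : ind (not b) ≡ ind (a ∧ not b) ℕ.+ ind (not a ∧ not b)
    on-y         : ind a ≡ ind (a ∧ b) ℕ.+ ind (a ∧ not b)
    on-¬y        : ind (not a) ≡ ind (not a ∧ b) ℕ.+ ind (not a ∧ not b)
    on-agree     : ind (if a then b else not b) ≡ ind (a ∧ b) ℕ.+ ind (not a ∧ not b)
    on-disagree  : ind (not (if a then b else not b)) ≡ ind (a ∧ not b) ℕ.+ ind (not a ∧ b)

cell-indicators-hold : ∀ a b → CellIndicators a b
cell-indicators-hold true  true  = cell-indicators refl refl refl refl refl refl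
cell-indicators-hold true  false = cell-indicators refl refl refl refl refl refl
cell-indicators-hold false true  = cell-indicators refl refl refl refl refl refl
cell-indicators-hold false false = cell-indicators refl refl refl refl refl refl

module _ {n} (y x : Fin n → Bool) where

  open CellIndicators

  private
    cells : ∀ i → CellIndicators (y i) (x i)
    cells i = cell-indicators-hold (y i) (x i)

  x-cells : DisjointUnion x (cellA₁ y x) (cellB₁ y x)
  x-cells = disjoint-union (on-x ∘ cells)

  ¬x-cells : DisjointUnion (not ∘ x) (cellA₂ y x) (cellB₂ y x)
  ¬x-cells = disjoint-union (on-¬x ∘ cells)

  y-cells : DisjointUnion y (cellA₁ y x) (cellA₂ y x)
  y-cells = disjoint-union (on-y ∘ cells)

  ¬y-cells : DisjointUnion (not ∘ y) (cellB₁ y x) (cellB₂ y x)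
  ¬y-cells = disjoint-union (on-¬y ∘ cells)

  agreement-cells : DisjointUnion (agreement y x) (cellA₁ y x) (cellB₂ y x)
  agreement-cells = disjoint-union (on-agree ∘ cells)

  disagreement-cells : DisjointUnion (not ∘ agreement y x) (cellA₂ y x) (cellB₁ y x)
  disagreement-cells = disjoint-union (on-disagree ∘ cells)

CellsBalanced : ∀ {n} → (Fin n → Bool) → (Fin n → Bool) → Set
CellsBalanced y x =
  count (cellA₁ y x) ≡ count (cellA₂ y x) × count (cellB₁ y x) ≡ count (cellB₂ y x)

equal-sums⇔ : ∀ a b c d →
  ((a ℕ.+ b ≡ c ℕ.+ d) × (a ℕ.+ d ≡ c ℕ.+ b)) ⇔ ((a ≡ c) × (b ≡ d))
equal-sums⇔ a b c d = mk⇔ to from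
  where
  to : (a ℕ.+ b ≡ c ℕ.+ d) × (a ℕ.+ d ≡ c ℕ.+ b) → (a ≡ c) × (b ≡ d)
  to (e₁ , e₂) = a≡c , ℕP.+-cancelˡ-≡ a b d (trans e₁ (cong (ℕ._+ d) (sym a≡c)))
    where
    open ≡-Reasoning
    doubled : (a ℕ.+ a) ℕ.+ (b ℕ.+ d) ≡ (c ℕ.+ c) ℕ.+ (b ℕ.+ d)
    doubled = begin
      (a ℕ.+ a) ℕ.+ (b ℕ.+ d)   ≡⟨ interchange a a b d ⟩
      (a ℕ.+ b) ℕ.+ (a ℕ.+ d)   ≡⟨ cong₂ ℕ._+_ e₁ e₂ ⟩
      (c ℕ.+ d) ℕ.+ (c ℕ.+ b)   ≡⟨ interchange c d c b ⟩
      (c ℕ.+ c) ℕ.+ (d ℕ.+ b)   ≡⟨ cong (c ℕ.+ c ℕ.+_) (ℕP.+-comm d b) ⟩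
      (c ℕ.+ c) ℕ.+ (b ℕ.+ d)   ∎
    a≡c : a ≡ c
    a≡c = begin
      a                  ≡⟨ ℕP.n≡⌊n+n/2⌋ a ⟩
      ⌊ a ℕ.+ a /2⌋      ≡⟨ cong ⌊_/2⌋ (ℕP.+-cancelʳ-≡ (b ℕ.+ d) (a ℕ.+ a) (c ℕ.+ c) doubled) ⟩
      ⌊ c ℕ.+ c /2⌋      ≡⟨ ℕP.n≡⌊n+n/2⌋ c ⟨
      c                  ∎
  from : (a ≡ c) × (b ≡ d) → (a ℕ.+ b ≡ c ℕ.+ d) × (a ℕ.+ d ≡ c ℕ.+ b)
  from (refl , refl) = refl , refl

feasible₂⇔cells-balanced : ∀ {n} (y x : Fin n → Bool) → Feasible₂ y x ⇔ CellsBalanced y x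
feasible₂⇔cells-balanced y x =
  equal-sums⇔ (count (cellA₁ y x)) (count (cellB₁ y x)) (count (cellA₂ y x)) (count (cellB₂ y x))
  ⇔-∘ ((≡-⇔ (count-⊎ (x-cells y x)) (count-⊎ (¬x-cells y x)) ⇔-∘ feasible₁⇔balanced x)
       ×-⇔ (≡-⇔ (count-⊎ (agreement-cells y x)) (count-⊎ (disagreement-cells y x))
            ⇔-∘ orthogonal⇔agreement-balanced y x))

cells-decomposition : ∀ {n} (y x : Fin n → Bool) → CellsBalanced y x →
  Decomposition y (λ i → not (y i)) (cellA₁ y x) (cellA₂ y x) (cellB₁ y x) (cellB₂ y x)
cells-decomposition y x (|A₁|≡|A₂| , |B₁|≡|B₂|) =
  (λ i → union (y i) (x i)) , (λ i → disjoint (y i) (x i)) ,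
  (λ i → union (not (y i)) (x i)) , (λ i → disjoint (not (y i)) (x i)) ,
  |A₁|≡|A₂| , |B₁|≡|B₂|
  where
  union : ∀ a b → a ≡ ((a ∧ b) ∨ (a ∧ not b))
  union true  true  = refl
  union true  false = refl
  union false _     = refl
  disjoint : ∀ a b → ((a ∧ b) ∧ (a ∧ not b)) ≡ false
  disjoint true  true  = refl
  disjoint true  false = refl
  disjoint false _     = refl

objective-of-cells : ∀ {n} (G : Graph n) (y x : Fin n → Bool) →
  organizedObjective G (cellA₁ y x) (cellA₂ y x) (cellB₁ y x) (cellB₂ y x)
    ≡ + cut G x - + cut G y
objective-of-cells G y x = begin
  + E G a₁ a₂ + + E G b₁ b₂ - + E G a₁ b₁ - + E G a₂ b₂
      ≡⟨ solve 6 (λ p q r s t u → p :+ s :- t :- u := (p :+ q :+ (r :+ s)) :- (t :+ q :+ (r :+ u)))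
           refl (+ E G a₁ a₂) (+ E G a₁ b₂) (+ E G a₂ b₁) (+ E G b₁ b₂) (+ E G a₁ b₁) (+ E G a₂ b₂) ⟩
  + ((E G a₁ a₂ ℕ.+ E G a₁ b₂) ℕ.+ (E G a₂ b₁ ℕ.+ E G b₁ b₂))
    - + ((E G a₁ b₁ ℕ.+ E G a₁ b₂) ℕ.+ (E G a₂ b₁ ℕ.+ E G a₂ b₂))
      ≡⟨ cong₂ (λ p q → + p - + q) cut-x cut-y ⟨
  + cut G x - + cut G y ∎
  where
  open ≡-Reasoning
  open +-*-Solver
  a₁ = cellA₁ y x
  a₂ = cellA₂ y x
  b₁ = cellB₁ y x
  b₂ = cellB₂ y x
  cut-x : cut G x ≡ (E G a₁ a₂ ℕ.+ E G a₁ b₂) ℕ.+ (E G a₂ b₁ ℕ.+ E G b₁ b₂)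
  cut-x = trans (E-⊎ G (x-cells y x) (¬x-cells y x))
                (cong (λ m → (E G a₁ a₂ ℕ.+ E G a₁ b₂) ℕ.+ (m ℕ.+ E G b₁ b₂)) (E-sym G b₁ a₂))
  cut-y : cut G y ≡ (E G a₁ b₁ ℕ.+ E G a₁ b₂) ℕ.+ (E G a₂ b₁ ℕ.+ E G a₂ b₂)
  cut-y = E-⊎ G (y-cells y x) (¬y-cells y x)

firstHalves : ∀ {n} → (Fin n → Bool) → (Fin n → Bool) → Fin n → Bool
firstHalves A₁ B₁ i = A₁ i ∨ B₁ i

part-is-cell : ∀ a a₁ a₂ b₁ b₂ → a ≡ (a₁ ∨ a₂) → (a₁ ∧ a₂) ≡ false →
  not a ≡ (b₁ ∨ b₂) → (b₁ ∧ b₂) ≡ false →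
  (a₁ ≡ (a ∧ (a₁ ∨ b₁))) × (a₂ ≡ (a ∧ not (a₁ ∨ b₁))) ×
  (b₁ ≡ (not a ∧ (a₁ ∨ b₁))) × (b₂ ≡ (not a ∧ not (a₁ ∨ b₁)))
part-is-cell _ true  true  _     _     refl ()   _    _
part-is-cell _ true  false true  _     refl refl ()   _
part-is-cell _ true  false false _     refl refl refl _    = refl , refl , refl , refl
part-is-cell _ false true  true  _     refl refl ()   _
part-is-cell _ false true  false _     refl refl refl _    = refl , refl , refl , refl
part-is-cell _ false false true  true  refl refl refl ()
part-is-cell _ false false true  false refl refl refl refl = refl , refl , refl , refl
part-is-cell _ false false false _     refl refl refl refl = refl , refl , refl , refl

decomposition-is-cells : ∀ {n} {y A₁ A₂ B₁ B₂ : Fin n → Bool} →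
  Decomposition y (λ i → not (y i)) A₁ A₂ B₁ B₂ →
  (A₁ ≗ cellA₁ y (firstHalves A₁ B₁)) × (A₂ ≗ cellA₂ y (firstHalves A₁ B₁)) ×
  (B₁ ≗ cellB₁ y (firstHalves A₁ B₁)) × (B₂ ≗ cellB₂ y (firstHalves A₁ B₁))
decomposition-is-cells {y = y} {A₁} {A₂} {B₁} {B₂} (y=A₁∪A₂ , A₁∩A₂=∅ , ¬y=B₁∪B₂ , B₁∩B₂=∅ , _) =
  (λ i → proj₁ (parts i)) , (λ i → proj₁ (proj₂ (parts i))) ,
  (λ i → proj₁ (proj₂ (proj₂ (parts i)))) , (λ i → proj₂ (proj₂ (proj₂ (parts i))))
  where
  parts = λ i → part-is-cell (y i) (A₁ i) (A₂ i) (B₁ i) (B₂ i)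
                  (y=A₁∪A₂ i) (A₁∩A₂=∅ i) (¬y=B₁∪B₂ i) (B₁∩B₂=∅ i)

decomposition-feasible : ∀ {n} {y A₁ A₂ B₁ B₂ : Fin n → Bool} →
  Decomposition y (λ i → not (y i)) A₁ A₂ B₁ B₂ → Feasible₂ y (firstHalves A₁ B₁)
decomposition-feasible {y = y} {A₁} {A₂} {B₁} {B₂} D@(_ , _ , _ , _ , |A₁|≡|A₂| , |B₁|≡|B₂|)
  with decomposition-is-cells D
... | A₁-cell , A₂-cell , B₁-cell , B₂-cell =
  Equivalence.from (feasible₂⇔cells-balanced y (firstHalves A₁ B₁))
    ( trans (sym (count-cong A₁-cell)) (trans |A₁|≡|A₂| (count-cong A₂-cell))
    , trans (sym (count-cong B₁-cell)) (trans |B₁|≡|B₂| (count-cong B₂-cell)))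

organizedObjective-cong : ∀ {n} (G : Graph n) {A₁ A₂ B₁ B₂ A₁' A₂' B₁' B₂' : Fin n → Bool} →
  A₁ ≗ A₁' → A₂ ≗ A₂' → B₁ ≗ B₁' → B₂ ≗ B₂' →
  organizedObjective G A₁ A₂ B₁ B₂ ≡ organizedObjective G A₁' A₂' B₁' B₂'
organizedObjective-cong G A₁≗ A₂≗ B₁≗ B₂≗ =
  cong₂ (λ p q → p - + q)
    (cong₂ (λ p q → p - + q)
      (cong₂ (λ p q → + p + + q) (E-cong G A₁≗ A₂≗) (E-cong G B₁≗ B₂≗))
      (E-cong G A₁≗ B₁≗))
    (E-cong G A₂≗ B₂≗)

minimizer₁-is-minimum-cut : ∀ {n} (G : Graph n) (y : Fin n → Bool) →
  Minimizer₁ G y → MinimumCut G y (λ i → not (y i))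
minimizer₁-is-minimum-cut G y (y-feasible , y-minimal) =
  ((λ _ → refl) , Equivalence.to (feasible₁⇔balanced y) y-feasible) , minimal
  where
  minimal : ∀ A B → Bisection A B → cut G y ℕ.≤ E G A B
  minimal A B (B≗¬A , |A|≡|B|) =
    subst (cut G y ℕ.≤_) (E-cong G {X = A} (λ _ → refl) (sym ∘ B≗¬A))
      (cut-mono G y A (y-minimal A A-feasible))
    where
    A-feasible : Feasible₁ A
    A-feasible = Equivalence.from (feasible₁⇔balanced A) (trans |A|≡|B| (count-cong B≗¬A))

-- The cells of a minimiser of the second problem form an organized partition:
-- their objective is cut(x) - cut(y), and any other decomposition has objective
-- cut(x') - cut(y) for a feasible x'.
minimizer₂-is-organized : ∀ {n} (G : Graph n) (y x : Fin n → Bool) → Minimizer₂ G y x →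
  OrganizedPartition G y (λ i → not (y i)) (cellA₁ y x) (cellA₂ y x) (cellB₁ y x) (cellB₂ y x)
minimizer₂-is-organized G y x (x-feasible , x-minimal) =
  cells-decomposition y x (Equivalence.to (feasible₂⇔cells-balanced y x) x-feasible) , optimal
  where
  optimal : ∀ A₁ A₂ B₁ B₂ → Decomposition y (λ i → not (y i)) A₁ A₂ B₁ B₂ →
    organizedObjective G (cellA₁ y x) (cellA₂ y x) (cellB₁ y x) (cellB₂ y x)
      ℤ.≤ organizedObjective G A₁ A₂ B₁ B₂
  optimal A₁ A₂ B₁ B₂ D with decomposition-is-cells D
  ... | A₁-cell , A₂-cell , B₁-cell , B₂-cell = begin
    organizedObjective G (cellA₁ y x) (cellA₂ y x) (cellB₁ y x) (cellB₂ y x)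
      ≡⟨ objective-of-cells G y x ⟩
    + cut G x - + cut G y
      ≤⟨ ℤP.+-monoˡ-≤ (- + cut G y) (ℤ.+≤+ x-beats-x') ⟩
    + cut G x' - + cut G y
      ≡⟨ objective-of-cells G y x' ⟨
    organizedObjective G (cellA₁ y x') (cellA₂ y x') (cellB₁ y x') (cellB₂ y x')
      ≡⟨ organizedObjective-cong G (sym ∘ A₁-cell) (sym ∘ A₂-cell) (sym ∘ B₁-cell) (sym ∘ B₂-cell) ⟩
    organizedObjective G A₁ A₂ B₁ B₂ ∎
    where
    open ℤP.≤-Reasoning
    x' = firstHalves A₁ B₁
    x-beats-x' : cut G x ℕ.≤ cut G x'
    x-beats-x' = cut-mono G x x' (x-minimal x' (decomposition-feasible D))

theorem9 : (n : ℕ) → 4 ∣ n → (G : Graph n) → Connected G →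
    (ybar xbar : Fin n → Bool) →
    Minimizer₁ G ybar → Minimizer₂ G ybar xbar →
    MinimumCut G ybar (λ i → not (ybar i)) ×
    OrganizedPartition G ybar (λ i → not (ybar i))
      (λ i → ybar i ∧ xbar i) (λ i → ybar i ∧ not (xbar i))
      (λ i → not (ybar i) ∧ xbar i) (λ i → not (ybar i) ∧ not (xbar i))
theorem9 _ _ G _ ybar xbar ybar-minimal xbar-minimal =
  minimizer₁-is-minimum-cut G ybar ybar-minimal ,
  minimizer₂-is-organized G ybar xbar xbar-minimal
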